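{- Let $P \subseteq S_n$ be a permutation array with Hamming distance $d$. Then $|P^{\mathsf{CT}^m}| = |P|$ for any positive integer $m < d/3$.
   Context: $S_n$ is the symmetric group on $\{0,1,\ldots,n-1\}$. A permutation array is a non-empty subset of $S_n$. The Hamming distance of $\sigma,\tau\in S_n$ is ${\rm hd}(\sigma,\tau)=|\{x: \sigma(x)\neq\tau(x)\}|$, and the Hamming distance of a permutation array $P$ is ${\rm hd}(P)=\min\{{\rm hd}(\sigma,\tau):\sigma,\tau\in P,\ \sigma\ne\tau\}$. The contraction of $\sigma\in S_n$ is the permutation $\sigma^{\mathsf{CT}}\in S_{n-1}$ (on $\{0,\ldots,n-2\}$) defined by $\sigma^{\mathsf{CT}}(x)=\sigma(n-1)$ if $x=\sigma^{ -1}(n-1)$ and $\sigma^{\mathsf{CT}}(x)=\sigma(x)$ otherwise (i.e. delete $n-1$ from the cycle notation of $\sigma$). For $1\le m\le n-1$, $\sigma^{\mathsf{CT}^m}:=\big(\sigma^{\mathsf{CT}^{m-1}}\big)^{\mathsf{CT}}$, and $P^{\mathsf{CT}^m}:=\{\sigma^{\mathsf{CT}^m}:\sigma\in P\}$. -}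

module Defs where

open import Data.Nat as ℕ using (ℕ; zero; suc; _∸_)
open import Data.Fin as F using (Fin; inject₁; fromℕ; toℕ; lower₁)
open import Data.Fin.Properties using () renaming (_≟_ to _≟ᶠ_)
open import Data.Vec using (Vec; lookup; tabulate)
open import Data.List using (List; length; filter; allFin)
open import Data.List.Membership.Propositional using (_∈_)
open import Data.Product using (Σ; _×_; ∃)
open import Relation.Nullary using (¬_; yes; no; ¬?)
open import Relation.Binary.PropositionalEquality using (_≡_; _≢_)

-- An element of S_n is represented by its one-line notation: a vector
-- v of length n with v[x] = σ(x), required to be injective (hence a
-- bijection of the finite set Fin n = {0,…,n-1}).
IsPerm : ∀ {n} → Vec (Fin n) n → Set
IsPerm {n} v = ∀ (x y : Fin n) → lookup v x ≡ lookup v y → x ≡ y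

hd : ∀ {n} → Vec (Fin n) n → Vec (Fin n) n → ℕ
hd {n} σ τ = length (filter (λ x → ¬? (lookup σ x ≟ᶠ lookup τ x)) (allFin n))

HasHD : ∀ {n} → List (Vec (Fin n) n) → ℕ → Set
HasHD P d =
  (∀ σ τ → σ ∈ P → τ ∈ P → σ ≢ τ → d ℕ.≤ hd σ τ)
  × (∃ λ σ → ∃ λ τ → σ ∈ P × τ ∈ P × σ ≢ τ × hd σ τ ≡ d)

-- View an element of Fin (suc n) as an element of Fin n when it is not
-- the top element n; the fallback is never used for permutations.
shrink : ∀ {n} → Fin (suc n) → Fin n → Fin n
shrink {n} z fb with n ℕ.≟ toℕ z
... | yes _ = fb
... | no p  = lower₁ z p

-- Contraction σ ↦ σ^CT : S_{n+1} → S_n (top element is n = fromℕ n):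
-- σ^CT(x) = σ(n) if σ(x) = n, and σ(x) otherwise.
ct : ∀ {n} → Vec (Fin (suc n)) (suc n) → Vec (Fin n) n
ct {n} σ = tabulate λ x →
  let y = lookup σ (inject₁ x) in
  shrink (helper y) x
  where
  helper : Fin (suc n) → Fin (suc n)
  helper y with y ≟ᶠ fromℕ n
  ... | yes _ = lookup σ (fromℕ n)
  ... | no _  = y

ctIter : ∀ m {n} → Vec (Fin n) n → Vec (Fin (n ∸ m)) (n ∸ m)
ctIter zero    σ = σ
ctIter (suc m) {zero}  σ = σ
ctIter (suc m) {suc n} σ = ctIter m {n} (ct σ)

-- A single contraction changes a permutation only at the preimage of the
-- top point n-1 and at n-1 itself. So if σ and τ disagree at some x < n-1
-- with σ(x), τ(x) ≠ n-1, then σ^CT and τ^CT still disagree at x; hence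
-- contraction lowers the Hamming distance by at most 3, and m contractions
-- by at most 3m. When 3m < d, the m-fold contraction keeps distinct
-- elements of P distinct, so it is injective on P.

module Submission where

open import Defs
open import Data.Nat using (ℕ; _*_; _<_; _≤_; _∸_)
open import Data.Fin using (Fin)
open import Data.Fin.Properties using () renaming (_≟_ to _≟ᶠ_)
open import Data.Vec using (Vec)
open import Data.Vec.Properties using (≡-dec)
open import Relation.Binary.PropositionalEquality using (_≡_)
open import Data.List using (List; length; map; deduplicate)
open import Data.List.Relation.Unary.All using (All)
open import Data.List.Relation.Unary.Unique.Propositional using (Unique)

open import Level using (Level)
open import Function using (id; _∘_; _∋_)
open import Data.Empty using (⊥-elim)
open import Data.Sum using (_⊎_; inj₁; inj₂)
open import Data.Product using (_,_)
open import Data.Nat using (zero; suc; _+_; z≤n; s≤s) renaming (_≟_ to _≟ⁿ_)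
open import Data.Nat.Properties
  using (≤-trans; ≤-reflexive; m≤n⇒m≤1+n; n≤1+n; +-suc; *-suc; +-assoc;
         +-comm; +-mono-≤; +-monoˡ-≤; +-monoʳ-≤; <-≤-trans; <-irrefl; m≤m+n; module ≤-Reasoning)
open import Data.Fin using (zero; suc; inject₁; fromℕ; toℕ)
open import Data.Fin.Properties
  using (toℕ-injective; toℕ-fromℕ; inject₁-lower₁; inject₁-injective; fromℕ≢inject₁)
open import Data.Vec using (lookup)
open import Data.Vec.Properties using (lookup∘tabulate)
open import Data.List using ([]; _∷_; _++_; _∷ʳ_; filter; tabulate; allFin)
open import Data.List.Properties
  using (length-filter; filter-none; filter-all; filter-++; length-++; length-map; map-tabulate)
open import Data.List.Membership.Propositional using (_∈_)
open import Data.List.Relation.Unary.Any using (here; there)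
import Data.List.Relation.Unary.All as All
import Data.List.Relation.Unary.All.Properties as All
open import Data.List.Relation.Unary.AllPairs using ([]; _∷_)
open import Data.List.Relation.Unary.Unique.Propositional.Properties using (allFin⁺)
open import Relation.Binary.Definitions using (DecidableEquality)
open import Relation.Binary.PropositionalEquality
  using (_≢_; refl; sym; trans; cong; module ≡-Reasoning)
open import Relation.Nullary using (yes; no; ¬?)
open import Relation.Unary using (Pred; Decidable)
open import Relation.Unary.Properties using (_∪?_)

private
  variable
    a p q r : Level
    A B : Set a

tabulate-∷ʳ : ∀ {n} (f : Fin (suc n) → A) →
              tabulate (f ∘ inject₁) ∷ʳ f (fromℕ n) ≡ tabulate f
tabulate-∷ʳ {n = zero}  f = refl
tabulate-∷ʳ {n = suc n} f = cong (f zero ∷_) (tabulate-∷ʳ (f ∘ suc))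

module _ {P : Pred A p} (P? : Decidable P) where

  length-filter-∷ʳ : ∀ xs x → length (filter P? (xs ∷ʳ x)) ≤ length (filter P? xs) + 1
  length-filter-∷ʳ xs x = begin
    length (filter P? (xs ∷ʳ x))                         ≡⟨ cong length (filter-++ P? xs (x ∷ [])) ⟩
    length (filter P? xs ++ filter P? (x ∷ []))          ≡⟨ length-++ (filter P? xs) ⟩
    length (filter P? xs) + length (filter P? (x ∷ []))  ≤⟨ +-monoʳ-≤ _ (length-filter P? (x ∷ [])) ⟩
    length (filter P? xs) + 1                            ∎
    where open ≤-Reasoning

  length-filter-map : (f : B → A) (xs : List B) →
                      length (filter P? (map f xs)) ≡ length (filter (P? ∘ f) xs)
  length-filter-map f []       = refl
  length-filter-map f (x ∷ xs) with P? (f x)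
  ... | yes _ = cong suc (length-filter-map f xs)
  ... | no _  = length-filter-map f xs

  length-filter-≤1 : (∀ {x y} → P x → P y → x ≡ y) →
                     ∀ {xs} → Unique xs → length (filter P? xs) ≤ 1
  length-filter-≤1 P-unique {[]}     []           = z≤n
  length-filter-≤1 P-unique {x ∷ xs} (x∉xs ∷ xs!) with P? x
  ... | no _   = length-filter-≤1 P-unique xs!
  ... | yes px = s≤s (≤-reflexive (cong length
                   (filter-none P? (All.map (λ x≢y py → x≢y (P-unique px py)) x∉xs))))

module _ {P : Pred A p} {Q : Pred A q} {R : Pred A r}
         (P? : Decidable P) (Q? : Decidable Q) (R? : Decidable R) where

  length-filter-⊎ : (∀ {x} → P x → Q x ⊎ R x) → ∀ xs →
                    length (filter P? xs) ≤ length (filter Q? xs) + length (filter R? xs)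
  length-filter-⊎ P⊆Q∪R []       = z≤n
  length-filter-⊎ P⊆Q∪R (x ∷ xs)
    with ih ← length-filter-⊎ P⊆Q∪R xs | P? x | Q? x | R? x
  ... | no _   | no _  | no _  = ih
  ... | no _   | yes _ | no _  = m≤n⇒m≤1+n ih
  ... | no _   | no _  | yes _ = ≤-trans ih (+-monoʳ-≤ _ (n≤1+n _))
  ... | no _   | yes _ | yes _ = ≤-trans ih (+-mono-≤ (n≤1+n _) (n≤1+n _))
  ... | yes _  | yes _ | no _  = s≤s ih
  ... | yes _  | yes _ | yes _ = s≤s (≤-trans ih (+-monoʳ-≤ _ (n≤1+n _)))
  ... | yes _  | no _  | yes _ = ≤-trans (s≤s ih) (≤-reflexive (sym (+-suc _ _)))
  ... | yes px | no ¬q | no ¬r with P⊆Q∪R px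
  ...   | inj₁ qx = ⊥-elim (¬q qx)
  ...   | inj₂ rx = ⊥-elim (¬r rx)

Unique-map-on : ∀ {f : A → B} {xs} →
                (∀ {x y} → x ∈ xs → y ∈ xs → x ≢ y → f x ≢ f y) →
                Unique xs → Unique (map f xs)
Unique-map-on {xs = []}     f-sep []           = []
Unique-map-on {xs = x ∷ xs} f-sep (x∉xs ∷ xs!) =
  All.map⁺ (All.tabulate (λ y∈xs → f-sep (here refl) (there y∈xs) (All.lookup x∉xs y∈xs)))
  ∷ Unique-map-on (λ x∈xs y∈xs → f-sep (there x∈xs) (there y∈xs)) xs!

deduplicate-Unique : (_≟_ : DecidableEquality A) → ∀ {xs} → Unique xs → deduplicate _≟_ xs ≡ xs
deduplicate-Unique _≟_ {[]}     []           = refl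
deduplicate-Unique _≟_ {x ∷ xs} (x∉xs ∷ xs!) rewrite deduplicate-Unique _≟_ xs! =
  cong (x ∷_) (filter-all (λ y → ¬? (x ≟ y)) x∉xs)

inject₁-shrink : ∀ {n} (z : Fin (suc n)) (fallback : Fin n) →
                 z ≢ fromℕ n → inject₁ (shrink z fallback) ≡ z
inject₁-shrink {n} z fallback z≢n with n ≟ⁿ toℕ z
... | yes n≡z = ⊥-elim (z≢n (toℕ-injective (trans (sym n≡z) (sym (toℕ-fromℕ n)))))
... | no n≢z  = inject₁-lower₁ z n≢z

module _ {n} (σ : Vec (Fin (suc n)) (suc n)) (x : Fin n) where

  -- The annotation makes Agda unfold ct σ to the tabulated function,
  -- so that the with below can see the case split inside ct.
  lookup-ct-≢ : lookup σ (inject₁ x) ≢ fromℕ n →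
                inject₁ (lookup (ct σ) x) ≡ lookup σ (inject₁ x)
  lookup-ct-≢ σx≢n rewrite (lookup (ct σ) x ≡ _ ∋ lookup∘tabulate _ x)
    with lookup σ (inject₁ x) ≟ᶠ fromℕ n
  ... | yes σx≡n = ⊥-elim (σx≢n σx≡n)
  ... | no _     = inject₁-shrink _ x σx≢n

  lookup-ct-≡ : lookup σ (inject₁ x) ≡ fromℕ n → lookup σ (fromℕ n) ≢ fromℕ n →
                inject₁ (lookup (ct σ) x) ≡ lookup σ (fromℕ n)
  lookup-ct-≡ σx≡n σn≢n rewrite (lookup (ct σ) x ≡ _ ∋ lookup∘tabulate _ x)
    with lookup σ (inject₁ x) ≟ᶠ fromℕ n
  ... | yes _    = inject₁-shrink _ x σn≢n
  ... | no σx≢n  = ⊥-elim (σx≢n σx≡n)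

data CtView {n} (σ : Vec (Fin (suc n)) (suc n)) (x : Fin n) : Set where
  hits-top   : lookup σ (inject₁ x) ≡ fromℕ n →
               inject₁ (lookup (ct σ) x) ≡ lookup σ (fromℕ n) → CtView σ x
  misses-top : lookup σ (inject₁ x) ≢ fromℕ n →
               inject₁ (lookup (ct σ) x) ≡ lookup σ (inject₁ x) → CtView σ x

ctView : ∀ {n} (σ : Vec (Fin (suc n)) (suc n)) → IsPerm σ → ∀ x → CtView σ x
ctView {n} σ σ-perm x with lookup σ (inject₁ x) ≟ᶠ fromℕ n
... | yes σx≡n = hits-top σx≡n (lookup-ct-≡ σ x σx≡n σn≢n)
  where
  σn≢n : lookup σ (fromℕ n) ≢ fromℕ n
  σn≢n σn≡n = fromℕ≢inject₁ (σ-perm _ _ (trans σn≡n (sym σx≡n)))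
... | no σx≢n  = misses-top σx≢n (lookup-ct-≢ σ x σx≢n)

ct-IsPerm : ∀ {n} (σ : Vec (Fin (suc n)) (suc n)) → IsPerm σ → IsPerm (ct σ)
ct-IsPerm σ σ-perm x y ct≡ with ctView σ σ-perm x | ctView σ σ-perm y
... | hits-top σx≡n _ | hits-top σy≡n _ =
  inject₁-injective (σ-perm _ _ (trans σx≡n (sym σy≡n)))
... | hits-top _ ctx | misses-top _ cty =
  ⊥-elim (fromℕ≢inject₁ (σ-perm _ _ (trans (sym ctx) (trans (cong inject₁ ct≡) cty))))
... | misses-top _ ctx | hits-top _ cty =
  ⊥-elim (fromℕ≢inject₁ (σ-perm _ _ (trans (sym cty) (trans (cong inject₁ (sym ct≡)) ctx))))
... | misses-top _ ctx | misses-top _ cty =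
  inject₁-injective (σ-perm _ _ (trans (sym ctx) (trans (cong inject₁ ct≡) cty)))

disagree? : ∀ {n} (σ τ : Vec (Fin n) n) → Decidable (λ x → lookup σ x ≢ lookup τ x)
disagree? σ τ x = ¬? (lookup σ x ≟ᶠ lookup τ x)

hits-top? : ∀ {n} (σ : Vec (Fin (suc n)) (suc n)) →
            Decidable (λ x → lookup σ (inject₁ x) ≡ fromℕ n)
hits-top? {n} σ x = lookup σ (inject₁ x) ≟ᶠ fromℕ n

hd-refl : ∀ {n} (σ : Vec (Fin n) n) → hd σ σ ≡ 0
hd-refl σ =
  cong length (filter-none (disagree? σ σ) (All.tabulate⁺ {f = id} (λ _ σx≢σx → σx≢σx refl)))

length-filter-hits-top : ∀ {n} (σ : Vec (Fin (suc n)) (suc n)) → IsPerm σ →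
                         length (filter (hits-top? σ) (allFin n)) ≤ 1
length-filter-hits-top {n} σ σ-perm =
  length-filter-≤1 (hits-top? σ)
    (λ σx≡n σy≡n → inject₁-injective (σ-perm _ _ (trans σx≡n (sym σy≡n)))) (allFin⁺ n)

hd-ct : ∀ {n} (σ τ : Vec (Fin (suc n)) (suc n)) → IsPerm σ → IsPerm τ →
        hd σ τ ≤ hd (ct σ) (ct τ) + 3
hd-ct {n} σ τ σ-perm τ-perm = begin
  hd σ τ
    ≡⟨ cong (length ∘ filter D?) (sym (tabulate-∷ʳ id)) ⟩
  length (filter D? (tabulate inject₁ ∷ʳ fromℕ n))
    ≤⟨ length-filter-∷ʳ D? (tabulate inject₁) (fromℕ n) ⟩
  length (filter D? (tabulate inject₁)) + 1
    ≡⟨ cong (λ xs → length (filter D? xs) + 1) (sym (map-tabulate id inject₁)) ⟩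
  length (filter D? (map inject₁ (allFin n))) + 1
    ≡⟨ cong (_+ 1) (length-filter-map D? inject₁ (allFin n)) ⟩
  length (filter (D? ∘ inject₁) (allFin n)) + 1
    ≤⟨ +-monoˡ-≤ 1 (length-filter-⊎ (D? ∘ inject₁) (disagree? (ct σ) (ct τ)) Top?
                                     disagree-lower (allFin n)) ⟩
  hd (ct σ) (ct τ) + length (filter Top? (allFin n)) + 1
    ≤⟨ +-monoˡ-≤ 1 (+-monoʳ-≤ (hd (ct σ) (ct τ)) tops) ⟩
  hd (ct σ) (ct τ) + 2 + 1
    ≡⟨ +-assoc (hd (ct σ) (ct τ)) 2 1 ⟩
  hd (ct σ) (ct τ) + 3 ∎
  where
  open ≤-Reasoning
  D? = disagree? σ τ
  Top? = hits-top? σ ∪? hits-top? τ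

  tops : length (filter Top? (allFin n)) ≤ 2
  tops = ≤-trans (length-filter-⊎ Top? (hits-top? σ) (hits-top? τ) id (allFin n))
                 (+-mono-≤ (length-filter-hits-top σ σ-perm) (length-filter-hits-top τ τ-perm))

  disagree-lower : ∀ {x} → lookup σ (inject₁ x) ≢ lookup τ (inject₁ x) →
                   lookup (ct σ) x ≢ lookup (ct τ) x
                   ⊎ (lookup σ (inject₁ x) ≡ fromℕ n ⊎ lookup τ (inject₁ x) ≡ fromℕ n)
  disagree-lower {x} σx≢τx with ctView σ σ-perm x | ctView τ τ-perm x
  ... | hits-top σx≡n _   | _                 = inj₂ (inj₁ σx≡n)
  ... | misses-top _ _    | hits-top τx≡n _   = inj₂ (inj₂ τx≡n)
  ... | misses-top _ ctσx | misses-top _ ctτx =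
    inj₁ (λ ct≡ → σx≢τx (trans (sym ctσx) (trans (cong inject₁ ct≡) ctτx)))

hd-ctIter : ∀ m {n} (σ τ : Vec (Fin n) n) → IsPerm σ → IsPerm τ →
            hd σ τ ≤ hd (ctIter m σ) (ctIter m τ) + 3 * m
hd-ctIter zero            σ τ _ _ = m≤m+n _ _
hd-ctIter (suc m) {zero}  σ τ _ _ = m≤m+n _ _
hd-ctIter (suc m) {suc n} σ τ σ-perm τ-perm = begin
  hd σ τ
    ≤⟨ hd-ct σ τ σ-perm τ-perm ⟩
  hd (ct σ) (ct τ) + 3
    ≤⟨ +-monoˡ-≤ 3 (hd-ctIter m (ct σ) (ct τ) (ct-IsPerm σ σ-perm) (ct-IsPerm τ τ-perm)) ⟩
  h + 3 * m + 3
    ≡⟨ +-assoc h (3 * m) 3 ⟩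
  h + (3 * m + 3)
    ≡⟨ cong (h +_) (trans (+-comm (3 * m) 3) (sym (*-suc 3 m))) ⟩
  h + 3 * suc m ∎
  where
  open ≤-Reasoning
  h = hd (ctIter (suc m) σ) (ctIter (suc m) τ)

ctIter-≢ : ∀ m {n} (σ τ : Vec (Fin n) n) → IsPerm σ → IsPerm τ →
           3 * m < hd σ τ → ctIter m σ ≢ ctIter m τ
ctIter-≢ m σ τ σ-perm τ-perm 3m<hd ctσ≡ctτ = <-irrefl refl (<-≤-trans 3m<hd (begin
  hd σ τ                                ≤⟨ hd-ctIter m σ τ σ-perm τ-perm ⟩
  hd (ctIter m σ) (ctIter m τ) + 3 * m  ≡⟨ cong (λ ρ → hd (ctIter m σ) ρ + 3 * m) (sym ctσ≡ctτ) ⟩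
  hd (ctIter m σ) (ctIter m σ) + 3 * m  ≡⟨ cong (_+ 3 * m) (hd-refl (ctIter m σ)) ⟩
  3 * m                                 ∎))
  where open ≤-Reasoning

theorem3p1 : ∀ (n : ℕ) (P : List (Vec (Fin n) n))
    → All IsPerm P → Unique P
    → ∀ (d : ℕ) → HasHD P d
    → ∀ (m : ℕ) → 1 ≤ m → 3 * m < d
    → length (deduplicate (≡-dec _≟ᶠ_) (map (ctIter m) P)) ≡ length P
theorem3p1 n P P-perm P! d (d≤hd , _) m _ 3m<d = begin
  length (deduplicate (≡-dec _≟ᶠ_) (map (ctIter m) P))
    ≡⟨ cong length (deduplicate-Unique (≡-dec _≟ᶠ_) (Unique-map-on separates P!)) ⟩
  length (map (ctIter m) P)
    ≡⟨ length-map (ctIter m) P ⟩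
  length P ∎
  where
  open ≡-Reasoning
  separates : ∀ {σ τ} → σ ∈ P → τ ∈ P → σ ≢ τ → ctIter m σ ≢ ctIter m τ
  separates {σ} {τ} σ∈P τ∈P σ≢τ =
    ctIter-≢ m σ τ (All.lookup P-perm σ∈P) (All.lookup P-perm τ∈P)
             (<-≤-trans 3m<d (d≤hd σ τ σ∈P τ∈P σ≢τ))
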